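{- Define integers $d_2 = 4$ and $d_j = j^{d_{j-1}/(j-1)}$ for $j \ge 3$, and for $k \ge 2$ let $\alpha_k = \prod_{j=2}^k (1 - 1/d_j)$. Then for each $k \ge 2$, the product $d_k \alpha_k$ is an integer. In particular, since $d_k$ is a power of $k$, $\alpha_k$ is a $k$-adic fraction (i.e., in lowest terms its denominator divides a power of $k$). -}

module Defs where

open import Data.Nat as ℕ using (ℕ; zero; suc; _^_; NonZero)
open import Data.Nat.Properties using (m^n≢0)
open import Data.Integer using (ℤ; +_)
open import Data.Rational using (ℚ; _/_; _*_; _-_; 1ℚ)

-- d j for j ≥ 2:  d 2 = 4,  d j = j ^ (d (j-1) / (j-1))   (ℕ division; exact by the paper)
-- d 0 = d 1 = 1 are junk values, never used by the statement.
d : ℕ → ℕ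
d 0 = 1
d 1 = 1
d 2 = 4
d (suc (suc (suc n))) = suc (suc (suc n)) ^ (d (suc (suc n)) ℕ./ suc (suc n))

d-nonZero : ∀ j → NonZero (d j)
d-nonZero 0 = _
d-nonZero 1 = _
d-nonZero 2 = _
d-nonZero (suc (suc (suc n))) = m^n≢0 (suc (suc (suc n))) (d (suc (suc n)) ℕ./ suc (suc n))

factor : ℕ → ℚ
factor j = 1ℚ - ((+ 1) / d j) {{d-nonZero j}}

α : ℕ → ℚ
α 0 = 1ℚ
α 1 = 1ℚ
α (suc (suc n)) = α (suc n) * factor (2 ℕ.+ n)

-- Write d_j = j ^ e_j. Since d_{j-1} = (j-1)^(b+1) is a power of j-1, the exponent
-- e_j = d_{j-1}/(j-1) = (j-1)^b is exact, and lifting the exponent gives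
-- j^((j-1)^b) ≡ 1 (mod (j-1)^(b+1)), i.e. d_j = 1 + q_j d_{j-1}. Hence
-- 1 - 1/d_j = q_j d_{j-1}/d_j, so if α_{j-1} = N/d_{j-1} then α_j = N q_j/d_j:
-- the denominator of α_k divides d_k, a power of k.
module Submission where

open import Defs
open import Data.List using ([]; _∷_)
open import Data.Nat as ℕ using (ℕ; zero; suc; pred; _+_; _^_; _≤_; s≤s; z≤n; NonZero)
import Data.Nat.Properties as ℕ
open import Data.Nat.Properties using (*-comm; *-identityˡ; ^-*-assoc; m^n≢0; suc-pred)
open import Data.Nat.DivMod using (m*n/n≡m)
open import Data.Nat.Divisibility using (_∣_; divides; m∣m*n)
open import Data.Nat.GCD using (gcd)
open import Data.Nat.Tactic.RingSolver using (solve)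
open import Data.Integer as ℤ using (+_; 1ℤ)
import Data.Integer.Properties as ℤ
open import Data.Integer.Properties using (pos-*; +-injective)
open import Data.Integer.Tactic.RingSolver using (solve-∀)
open import Data.Rational using (_/_; _*_; _-_; -_; 1ℚ; ↧ₙ_; toℚᵘ)
open import Data.Rational.Properties
  using (toℚᵘ-injective; toℚᵘ-fromℚᵘ; toℚᵘ-homo-*; toℚᵘ-homo-+; toℚᵘ-homo‿-; /-cong; ↧-/)
open import Data.Rational.Unnormalised as ℚᵘ using (mkℚᵘ; *≡*)
  renaming (_≃_ to _≃ᵘ_; _/_ to _/ᵘ_)
import Data.Rational.Unnormalised.Properties as ℚᵘ
open import Data.Product using (_×_; _,_; ∃-syntax)
open import Relation.Binary.PropositionalEquality
  using (_≡_; refl; sym; trans; cong; subst; subst₂; module ≡-Reasoning)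

infix 4 _≡1-mod_

_≡1-mod_ : ℕ → ℕ → Set
x ≡1-mod n = ∃[ q ] x ≡ 1 + q ℕ.* n

[1+y]^m≡1+m*y+y*y*r : ∀ y m → ∃[ r ] (1 + y) ^ m ≡ 1 + m ℕ.* y + y ℕ.* y ℕ.* r
[1+y]^m≡1+m*y+y*y*r y zero    = 0 , solve (y ∷ [])
[1+y]^m≡1+m*y+y*y*r y (suc m) with [1+y]^m≡1+m*y+y*y*r y m
... | r , eq = r + m + y ℕ.* r , trans (cong ((1 + y) ℕ.*_) eq) (solve (y ∷ m ∷ r ∷ []))

-- (1 + q n)^m = 1 + m q n + (q n)² r, and m ∣ n makes (q n)² divisible by m n.
≡1-mod-lift : ∀ {x n} m → m ∣ n → x ≡1-mod n → x ^ m ≡1-mod m ℕ.* n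
≡1-mod-lift m (divides c refl) (q , refl) with [1+y]^m≡1+m*y+y*y*r (q ℕ.* (c ℕ.* m)) m
... | r , eq = q + q ℕ.* q ℕ.* c ℕ.* r , trans eq (solve (q ∷ c ∷ m ∷ r ∷ []))

[1+m]^[m^b]≡1-mod-m^[1+b] : ∀ m b → (1 + m) ^ (m ^ b) ≡1-mod m ^ suc b
[1+m]^[m^b]≡1-mod-m^[1+b] m zero    = 1 , cong suc (sym (*-identityˡ (m ℕ.* 1)))
[1+m]^[m^b]≡1-mod-m^[1+b] m (suc b) =
  subst (_≡1-mod m ^ suc (suc b)) [x^m^b]^m≡x^m^[1+b]
    (≡1-mod-lift m (m∣m*n (m ^ b)) ([1+m]^[m^b]≡1-mod-m^[1+b] m b))
  where
  [x^m^b]^m≡x^m^[1+b] : ((1 + m) ^ (m ^ b)) ^ m ≡ (1 + m) ^ (m ^ suc b)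
  [x^m^b]^m≡x^m^[1+b] = trans (^-*-assoc (1 + m) (m ^ b) m) (cong ((1 + m) ^_) (*-comm (m ^ b) m))

d-pow-step : ∀ n b → d (2 + n) ≡ (2 + n) ^ suc b → d (3 + n) ≡ (3 + n) ^ ((2 + n) ^ b)
d-pow-step n b eq = cong ((3 + n) ^_) (begin
  d (2 + n) ℕ./ (2 + n)               ≡⟨ cong (ℕ._/ (2 + n)) eq ⟩
  (2 + n) ℕ.* (2 + n) ^ b ℕ./ (2 + n) ≡⟨ cong (ℕ._/ (2 + n)) (*-comm (2 + n) ((2 + n) ^ b)) ⟩
  (2 + n) ^ b ℕ.* (2 + n) ℕ./ (2 + n) ≡⟨ m*n/n≡m ((2 + n) ^ b) (2 + n) ⟩
  (2 + n) ^ b                         ∎)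
  where open ≡-Reasoning

d-pow : ∀ n → ∃[ b ] d (2 + n) ≡ (2 + n) ^ suc b
d-pow zero    = 1 , refl
d-pow (suc n) with d-pow n
... | b , eq = pred ((2 + n) ^ b) ,
  trans (d-pow-step n b eq) (cong ((3 + n) ^_) (sym (suc-pred ((2 + n) ^ b) {{m^n≢0 (2 + n) b}})))

d[3+n]≡1-mod-d[2+n] : ∀ n → d (3 + n) ≡1-mod d (2 + n)
d[3+n]≡1-mod-d[2+n] n with d-pow n
... | b , eq = subst₂ _≡1-mod_ (sym (d-pow-step n b eq)) (sym eq) ([1+m]^[m^b]≡1-mod-m^[1+b] (2 + n) b)

toℚᵘ-/ : ∀ i n .{{_ : NonZero n}} → toℚᵘ (i / n) ≃ᵘ i /ᵘ n
toℚᵘ-/ i (suc n) = toℚᵘ-fromℚᵘ (mkℚᵘ i n)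

/-*-/ : ∀ i j m n .{{_ : NonZero m}} .{{_ : NonZero n}} .{{_ : NonZero (m ℕ.* n)}} →
        (i / m) * (j / n) ≡ (i ℤ.* j) / (m ℕ.* n)
/-*-/ i j m@(suc _) n@(suc _) = toℚᵘ-injective (begin
  toℚᵘ ((i / m) * (j / n))       ≈⟨ toℚᵘ-homo-* (i / m) (j / n) ⟩
  toℚᵘ (i / m) ℚᵘ.* toℚᵘ (j / n) ≈⟨ ℚᵘ.*-cong (toℚᵘ-/ i m) (toℚᵘ-/ j n) ⟩
  (i ℤ.* j) /ᵘ (m ℕ.* n)         ≈⟨ toℚᵘ-/ (i ℤ.* j) (m ℕ.* n) ⟨
  toℚᵘ ((i ℤ.* j) / (m ℕ.* n))   ∎)
  where open ℚᵘ.≃-Reasoning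

*-cancelʳ-/ : ∀ p {i n} .{{_ : NonZero n}} .{{_ : NonZero (n ℕ.* p)}} →
              (i ℤ.* + p) / (n ℕ.* p) ≡ i / n
*-cancelʳ-/ p {i} {n} = toℚᵘ-injective (begin
  toℚᵘ ((i ℤ.* + p) / (n ℕ.* p)) ≈⟨ toℚᵘ-/ (i ℤ.* + p) (n ℕ.* p) ⟩
  (i ℤ.* + p) /ᵘ (n ℕ.* p)       ≈⟨ ℚᵘ.*-cancelʳ-/ p ⟩
  i /ᵘ n                         ≈⟨ toℚᵘ-/ i n ⟨
  toℚᵘ (i / n)                   ∎)
  where open ℚᵘ.≃-Reasoning

1-1/[1+m]≡m/[1+m] : ∀ m → 1ℚ - + 1 / suc m ≡ + m / suc m
1-1/[1+m]≡m/[1+m] m = toℚᵘ-injective (begin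
  toℚᵘ (1ℚ - + 1 / suc m)                ≈⟨ toℚᵘ-homo-+ 1ℚ (- (+ 1 / suc m)) ⟩
  ℚᵘ.1ℚᵘ ℚᵘ.+ toℚᵘ (- (+ 1 / suc m))     ≈⟨ ℚᵘ.+-congʳ ℚᵘ.1ℚᵘ (toℚᵘ-homo‿- (+ 1 / suc m)) ⟩
  ℚᵘ.1ℚᵘ ℚᵘ.- toℚᵘ (+ 1 / suc m)         ≈⟨ ℚᵘ.+-congʳ ℚᵘ.1ℚᵘ (ℚᵘ.-‿cong (toℚᵘ-/ (+ 1) (suc m))) ⟩
  ℚᵘ.1ℚᵘ ℚᵘ.- + 1 /ᵘ suc m               ≈⟨ *≡* (cross-multiplied (+ m)) ⟩
  + m /ᵘ suc m                           ≈⟨ toℚᵘ-/ (+ m) (suc m) ⟨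
  toℚᵘ (+ m / suc m)                     ∎)
  where
  open ℚᵘ.≃-Reasoning
  -- `+ suc m` is definitionally `1ℤ ℤ.+ + m`, so the goal of `*≡*` is this identity at M = + m.
  cross-multiplied : ∀ M → (1ℤ ℤ.* (1ℤ ℤ.+ M) ℤ.+ ℤ.- 1ℤ ℤ.* 1ℤ) ℤ.* (1ℤ ℤ.+ M) ≡ M ℤ.* (1ℤ ℤ.* (1ℤ ℤ.+ M))
  cross-multiplied = solve-∀

n/d*[1-1/d′]≡n*q/d′ : ∀ n q d d′ .{{_ : NonZero d}} .{{_ : NonZero d′}} → d′ ≡ 1 + q ℕ.* d →
  (+ n / d) * (1ℚ - + 1 / d′) ≡ + (n ℕ.* q) / d′
n/d*[1-1/d′]≡n*q/d′ n q d@(suc _) _ refl = begin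
  (+ n / d) * (1ℚ - + 1 / suc (q ℕ.* d))         ≡⟨ cong (+ n / d *_) (1-1/[1+m]≡m/[1+m] (q ℕ.* d)) ⟩
  (+ n / d) * (+ (q ℕ.* d) / suc (q ℕ.* d))      ≡⟨ /-*-/ (+ n) (+ (q ℕ.* d)) d (suc (q ℕ.* d)) ⟩
  (+ n ℤ.* + (q ℕ.* d)) / (d ℕ.* suc (q ℕ.* d))  ≡⟨ /-cong n*[q*d]≡[n*q]*d (*-comm d (suc (q ℕ.* d))) ⟩
  (+ (n ℕ.* q) ℤ.* + d) / (suc (q ℕ.* d) ℕ.* d)  ≡⟨ *-cancelʳ-/ d {+ (n ℕ.* q)} {suc (q ℕ.* d)} ⟩
  + (n ℕ.* q) / suc (q ℕ.* d)                    ∎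
  where
  open ≡-Reasoning
  n*[q*d]≡[n*q]*d : + n ℤ.* + (q ℕ.* d) ≡ + (n ℕ.* q) ℤ.* + d
  n*[q*d]≡[n*q]*d = trans (sym (pos-* n (q ℕ.* d)))
    (trans (cong +_ (sym (ℕ.*-assoc n q d))) (pos-* (n ℕ.* q) d))

n/1*m/n≡m/1 : ∀ m n .{{_ : NonZero n}} → (+ n / 1) * (+ m / n) ≡ + m / 1
n/1*m/n≡m/1 m n@(suc _) = begin
  (+ n / 1) * (+ m / n)    ≡⟨ /-*-/ (+ n) (+ m) 1 n ⟩
  (+ n ℤ.* + m) / (1 ℕ.* n) ≡⟨ /-cong (ℤ.*-comm (+ n) (+ m)) refl ⟩
  (+ m ℤ.* + n) / (1 ℕ.* n) ≡⟨ *-cancelʳ-/ n {+ m} {1} ⟩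
  + m / 1                  ∎
  where open ≡-Reasoning

↧ₙ[i/n]∣n : ∀ i n .{{_ : NonZero n}} → ↧ₙ (i / n) ∣ n
↧ₙ[i/n]∣n i n = subst (↧ₙ (i / n) ∣_) ↧ₙ[i/n]*g≡n (m∣m*n g)
  where
  g : ℕ
  g = gcd ℤ.∣ i ∣ n
  ↧ₙ[i/n]*g≡n : ↧ₙ (i / n) ℕ.* g ≡ n
  ↧ₙ[i/n]*g≡n = +-injective (trans (pos-* (↧ₙ (i / n)) g) (↧-/ i n))

α≡n/d : ∀ n → ∃[ N ] α (2 + n) ≡ (+ N / d (2 + n)) {{d-nonZero (2 + n)}}
α≡n/d zero    = 3 , refl
α≡n/d (suc n) with α≡n/d n | d[3+n]≡1-mod-d[2+n] n
... | N , α≡ | q , d≡ = N ℕ.* q ,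
  trans (cong (_* factor (3 + n)) α≡)
    (n/d*[1-1/d′]≡n*q/d′ N q (d (2 + n)) (d (3 + n)) {{d-nonZero (2 + n)}} {{d-nonZero (3 + n)}} d≡)

lemma5 : ∀ (k : ℕ) → 2 ≤ k →
    (∃[ z ] ((+ d k) / 1) * α k ≡ z / 1) ×
    (∃[ m ] d k ≡ k ^ m) ×
    (∃[ m ] (↧ₙ α k) ∣ k ^ m)
lemma5 (suc (suc n)) (s≤s (s≤s z≤n)) with α≡n/d n | d-pow n
... | N , α≡ | b , d≡ = (+ N , d*α≡N) , (suc b , d≡) , (suc b , subst (↧ₙ α k ∣_) d≡ ↧ₙα∣d)
  where
  k : ℕ
  k = 2 + n
  instance
    d[k]≢0 : NonZero (d k)
    d[k]≢0 = d-nonZero k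
  d*α≡N : (+ d k / 1) * α k ≡ + N / 1
  d*α≡N = trans (cong (+ d k / 1 *_) α≡) (n/1*m/n≡m/1 N (d k))
  ↧ₙα∣d : ↧ₙ α k ∣ d k
  ↧ₙα∣d = subst (λ x → ↧ₙ x ∣ d k) (sym α≡) (↧ₙ[i/n]∣n (+ N) (d k))
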